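{- Let $G$ be a geodetic $2$-connected graph that is not complete, and suppose $G$ contains a clique on $m>1$ vertices. Then $G$ contains $K_{1,m}$ as an induced subgraph.
   Context: A geodesic is a shortest path; a graph is geodetic if between any two vertices there is exactly one geodesic. $K_{1,m}$ is the star with $m$ leaves. -}

module Defs where

open import Data.Nat using (ℕ; zero; suc; _<_; _≤_)
open import Data.Fin using (Fin)
open import Data.Bool using (Bool; true; false)
open import Data.Vec using (Vec; _∷_; [])
open import Data.Vec.Relation.Unary.All using (All)
open import Data.Product using (Σ; _×_; ∃; ∃-syntax; _,_)
open import Relation.Binary.PropositionalEquality using (_≡_; _≢_)
open import Relation.Nullary using (¬_)
open import Function.Definitions using (Injective)

record Graph (n : ℕ) : Set where
  field
    Adj    : Fin n → Fin n → Bool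
    sym    : ∀ u v → Adj u v ≡ Adj v u
    irrefl : ∀ u → Adj u u ≡ false

open Graph public

module _ {n : ℕ} (G : Graph n) where

  E : Fin n → Fin n → Set
  E u v = Adj G u v ≡ true

  data Walk : Fin n → Fin n → ℕ → Set where
    here : ∀ u → Walk u u zero
    step : ∀ {u v w k} → E u v → Walk v w k → Walk u w (suc k)

  vertices : ∀ {u v k} → Walk u v k → Vec (Fin n) (suc k)
  vertices (here u) = u ∷ []
  vertices (step {u = u} _ p) = u ∷ vertices p

  IsGeodesic : ∀ {u v k} → Walk u v k → Set
  IsGeodesic {u} {v} {k} _ = ∀ j → Walk u v j → k ≤ j

  Geodetic : Set
  Geodetic = ∀ u v →
      (Σ ℕ λ k → Σ (Walk u v k) IsGeodesic)
    × (∀ k (p q : Walk u v k) → IsGeodesic p → IsGeodesic q →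
         vertices p ≡ vertices q)

  Connected : Set
  Connected = ∀ u v → ∃[ k ] Walk u v k

  ConnectedWithout : Fin n → Set
  ConnectedWithout x = ∀ u v → u ≢ x → v ≢ x →
    ∃[ k ] Σ (Walk u v k) λ p → All (λ y → y ≢ x) (vertices p)

  TwoConnected : Set
  TwoConnected = 2 < n × Connected × (∀ x → ConnectedWithout x)

  Complete : Set
  Complete = ∀ u v → u ≢ v → E u v

  HasClique : ℕ → Set
  HasClique m = Σ (Fin m → Fin n) λ f → Injective _≡_ _≡_ f
    × (∀ i j → i ≢ j → E (f i) (f j))

  -- G contains K_{1,m} as an induced subgraph: a centre c and m distinct
  -- leaves, each adjacent to c, pairwise non-adjacent.
  -- (c differs from every leaf since c is adjacent to it.)
  HasInducedStar : ℕ → Set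
  HasInducedStar m = Σ (Fin n) λ c → Σ (Fin m → Fin n) λ g →
      Injective _≡_ _≡_ g
    × (∀ i → E c (g i))
    × (∀ i j → ¬ E (g i) (g j))

-- Extend the clique K to a maximal one and sort the vertices by their distances to K.
-- Distances from the vertices of K to a vertex y differ by at most one, and in a geodetic
-- graph the minimum cannot be attained twice unless all of K is equidistant from y:
-- otherwise a farther vertex of K would have two geodesics to y.  So every vertex is either
-- equidistant from K or has a unique nearest vertex in K, and an edge between the regions
-- of two different clique vertices can only leave from a clique vertex.  If no vertex were
-- equidistant, a path in G - f a from a vertex outside K in the region of f a to another
-- clique vertex f w would never leave that region, although f w lies in its own.  For a
-- nearest equidistant vertex z, at distance at least 2 by maximality, the successors of z
-- on its geodesics to the vertices of K lie in pairwise different regions, so they are the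
-- leaves of an induced star centred at z.
module Submission where

open import Defs hiding (sym)
open import Data.Nat using (ℕ; zero; suc; _<_; _≤_; _+_; s≤s) renaming (_≟_ to _≟ℕ_)
open import Data.Nat.Properties
  using (≤-antisym; ≤-pred; ≤-trans; ≤-refl; <-≤-trans; ≤∧≢⇒<; m≤n⇒m<n∨m≡n; 1+n≢n; <⇒≱;
         n≤1+n; n≤0⇒n≡0; +-suc; +-identityʳ; m≤n+m; n≮0; <-asym)
open import Data.Fin using (Fin; zero; suc; inject≤) renaming (_≟_ to _≟Fin_)
open import Data.Fin.Properties using (any?; all?; injective⇒≤; inject≤-injective)
open import Data.Bool using (true) renaming (_≟_ to _≟Bool_)
open import Data.Vec using (head; tail)
import Data.Vec.Functional as Vector
open import Data.Vec.Relation.Unary.All using (All; _∷_)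
open import Data.List using (List; allFin; filter)
open import Data.List.Extrema.Nat using (argmin; argmin-all; f[argmin]≤f[xs])
import Data.List.Relation.Unary.All as ListAll
open import Data.List.Relation.Unary.All.Properties using (all-filter)
open import Data.List.Membership.Propositional.Properties using (∈-filter⁺; ∈-allFin)
open import Data.Product using (Σ; _×_; ∃; ∃₂; _,_; proj₁; proj₂)
open import Data.Sum using (_⊎_; inj₁; inj₂)
open import Data.Empty using (⊥-elim)
open import Data.Unit using (tt)
open import Relation.Nullary using (¬_; Dec; yes; no)
open import Relation.Nullary.Decidable using (¬?; _×-dec_; decidable-stable)
open import Relation.Unary using (Pred; Decidable)
open import Relation.Unary.Properties using (U?)
open import Relation.Binary.PropositionalEquality using (_≡_; _≢_; refl; sym; trans; cong; subst)
open import Function using (_∘_)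
open import Function.Definitions using (Injective)

minimiser : ∀ {k p} {P : Pred (Fin k) p} → Decidable P → (h : Fin k → ℕ) → ∃ P →
            ∃ λ z → P z × (∀ {z′} → P z′ → h z ≤ h z′)
minimiser {k} P? h (z₀ , Pz₀) =
  z , argmin-all h Pz₀ (all-filter P? (allFin k)) ,
  λ Pz′ → ListAll.lookup (f[argmin]≤f[xs] z₀ candidates) (∈-filter⁺ P? (∈-allFin _) Pz′)
  where
  candidates : List (Fin k)
  candidates = filter P? (allFin k)
  z : Fin k
  z = argmin h z₀ candidates

distinct-pair : ∀ {k} → 1 < k → ∃₂ λ (i j : Fin k) → i ≢ j
distinct-pair {suc (suc _)} _ = zero , suc zero , λ ()
distinct-pair {suc zero} (s≤s ())

other-index : ∀ {k} → 1 < k → (a : Fin k) → ∃ λ b → b ≢ a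
other-index {suc (suc _)} _ zero    = suc zero , λ ()
other-index {suc (suc _)} _ (suc _) = zero , λ ()
other-index {suc zero} (s≤s ()) _

module _ {n : ℕ} (G : Graph n) where

  E? : ∀ u v → Dec (E G u v)
  E? u v = Adj G u v ≟Bool true

  E-sym : ∀ {u v} → E G u v → E G v u
  E-sym {u} {v} e = trans (Graph.sym G v u) e

  E-irrefl : ∀ {u} → ¬ E G u u
  E-irrefl {u} e with trans (sym e) (irrefl G u)
  ... | ()

  snoc : ∀ {u v w k} → Walk G u v k → E G v w → Walk G u w (suc k)
  snoc (here _)   e′ = step e′ (here _)
  snoc (step e p) e′ = step e (snoc p e′)

  reverse : ∀ {u v k} → Walk G u v k → Walk G v u k
  reverse (here u)   = here u
  reverse (step e p) = snoc (reverse p) (E-sym e)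

  uncons : ∀ {u w k} → Walk G u w (suc k) → ∃ λ v → E G u v × Walk G v w k
  uncons (step e p) = _ , e , p

  head-vertices : ∀ {u v k} (p : Walk G u v k) → head (vertices G p) ≡ u
  head-vertices (here _)   = refl
  head-vertices (step _ _) = refl

  IsClique : ∀ {k} → (Fin k → Fin n) → Set
  IsClique f = Injective _≡_ _≡_ f × (∀ i j → i ≢ j → E G (f i) (f j))

  -- For a clique this is maximality: a clique vertex is never adjacent to itself.
  Maximal : ∀ {k} → (Fin k → Fin n) → Set
  Maximal f = ∀ x → ¬ (∀ i → E G x (f i))

  cons-clique : ∀ {k x} {f : Fin k → Fin n} → IsClique f → (∀ i → E G x (f i)) →
                IsClique (x Vector.∷ f)
  cons-clique {x = x} {f} (inj , adj) x-adj = inj′ , adj′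
    where
    inj′ : Injective _≡_ _≡_ (x Vector.∷ f)
    inj′ {zero}  {zero}  _  = refl
    inj′ {zero}  {suc j} eq = ⊥-elim (E-irrefl (subst (E G x) (sym eq) (x-adj j)))
    inj′ {suc i} {zero}  eq = ⊥-elim (E-irrefl (subst (E G x) eq (x-adj i)))
    inj′ {suc i} {suc j} eq = cong suc (inj eq)
    adj′ : ∀ i j → i ≢ j → E G ((x Vector.∷ f) i) ((x Vector.∷ f) j)
    adj′ zero    zero    i≢j = ⊥-elim (i≢j refl)
    adj′ zero    (suc j) _   = x-adj j
    adj′ (suc i) zero    _   = E-sym (x-adj i)
    adj′ (suc i) (suc j) i≢j = adj i j (i≢j ∘ cong suc)

  MaximalCliqueOfSize≥ : ℕ → Set
  MaximalCliqueOfSize≥ k = ∃ λ k′ → k ≤ k′ × Σ (Fin k′ → Fin n) λ f → IsClique f × Maximal f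

  extend-to-maximal′ : ∀ b {k} {f : Fin k → Fin n} → n ≤ k + b → IsClique f →
                       MaximalCliqueOfSize≥ k
  extend-to-maximal′ b {k} {f} n≤k+b clique with any? (λ x → all? (λ i → E? x (f i)))
  ... | no none = k , ≤-refl , f , clique , λ x x-adj → none (x , x-adj)
  extend-to-maximal′ zero {k} n≤k clique | yes (x , x-adj) =
    ⊥-elim (<⇒≱ (injective⇒≤ (proj₁ (cons-clique clique x-adj)))
                (subst (n ≤_) (+-identityʳ k) n≤k))
  extend-to-maximal′ (suc b) {k} n≤k+b clique | yes (x , x-adj)
    with extend-to-maximal′ b (subst (n ≤_) (+-suc k b) n≤k+b) (cons-clique clique x-adj)
  ... | k′ , k<k′ , maximal = k′ , ≤-trans (n≤1+n k) k<k′ , maximal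

  extend-to-maximal : ∀ {k} {f : Fin k → Fin n} → IsClique f → MaximalCliqueOfSize≥ k
  extend-to-maximal {k} = extend-to-maximal′ n (m≤n+m n k)

  vertex-outside-clique : ∀ {k} {f : Fin k → Fin n} → IsClique f → ¬ Complete G →
                          ∃ λ x → ∀ i → x ≢ f i
  vertex-outside-clique {f = f} (_ , adj) incomplete
    with any? (λ x → ¬? (any? (λ i → x ≟Fin f i)))
  ... | yes (x , x∉) = x , λ i x≡fi → x∉ (i , x≡fi)
  ... | no none = ⊥-elim (incomplete complete)
    where
    in-clique : ∀ u → ∃ λ i → u ≡ f i
    in-clique u = decidable-stable (any? (λ i → u ≟Fin f i)) (λ u∉ → none (u , u∉))
    complete : Complete G
    complete u v u≢v with in-clique u | in-clique v
    ... | i , refl | j , refl = adj i j (u≢v ∘ cong f)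

  HasInducedStar-mono : ∀ {k m} → m ≤ k → HasInducedStar G k → HasInducedStar G m
  HasInducedStar-mono m≤k (c , g , g-inj , c-adj , g-indep) =
    c , (λ i → g (inject≤ i m≤k)) ,
    (λ {i} {j} eq → inject≤-injective m≤k m≤k i j (g-inj eq)) ,
    (λ _ → c-adj _) , (λ _ _ → g-indep _ _)

module GeodeticDistance {n : ℕ} {G : Graph n} (geodetic : Geodetic G) where

  dist : Fin n → Fin n → ℕ
  dist u v = proj₁ (proj₁ (geodetic u v))

  geodesic : ∀ u v → Walk G u v (dist u v)
  geodesic u v = proj₁ (proj₂ (proj₁ (geodetic u v)))

  geodesic-of-length : ∀ {u v k} → dist u v ≡ k → Walk G u v k
  geodesic-of-length {u} {v} eq = subst (Walk G u v) eq (geodesic u v)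

  dist-minimal : ∀ {u v k} → Walk G u v k → dist u v ≤ k
  dist-minimal {u} {v} {k} p = proj₂ (proj₂ (proj₁ (geodetic u v))) k p

  dist-sym : ∀ u v → dist u v ≡ dist v u
  dist-sym u v = ≤-antisym (dist-minimal (reverse G (geodesic v u)))
                           (dist-minimal (reverse G (geodesic u v)))

  dist-refl : ∀ u → dist u u ≡ 0
  dist-refl u = n≤0⇒n≡0 (dist-minimal (here u))

  dist≡0⇒≡ : ∀ {u v} → dist u v ≡ 0 → u ≡ v
  dist≡0⇒≡ eq with geodesic-of-length eq
  ... | here _ = refl

  dist≡1⇒E : ∀ {u v} → dist u v ≡ 1 → E G u v
  dist≡1⇒E eq with geodesic-of-length eq
  ... | step e (here _) = e

  dist-stepˡ : ∀ {x y z} → E G x y → dist x z ≤ suc (dist y z)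
  dist-stepˡ {y = y} {z} e = dist-minimal (step e (geodesic y z))

  dist-stepʳ : ∀ {x y z} → E G y z → dist x y ≤ suc (dist x z)
  dist-stepʳ {x} {z = z} e = dist-minimal (snoc G (geodesic x z) (E-sym G e))

  geodesic-successor-unique : ∀ {x y a b k} → E G x a → E G x b →
                              Walk G a y k → Walk G b y k → dist x y ≡ suc k → a ≡ b
  geodesic-successor-unique {x} {y} {k = k} xa xb p q dist≡ =
    trans (sym (head-vertices G p))
          (trans (cong (head ∘ tail) same-vertices) (head-vertices G q))
    where
    shortest : ∀ (r : Walk G x y (suc k)) → IsGeodesic G r
    shortest _ j r′ = subst (_≤ j) dist≡ (dist-minimal r′)
    same-vertices : vertices G (step xa p) ≡ vertices G (step xb q)
    same-vertices = proj₂ (geodetic x y) (suc k) (step xa p) (step xb q)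
                      (shortest (step xa p)) (shortest (step xb q))

module CliqueRegions {n : ℕ} {G : Graph n} (geodetic : Geodetic G)
                     {k : ℕ} {f : Fin k → Fin n} (clique : IsClique G f) where

  open GeodeticDistance geodetic

  private
    f-injective : Injective _≡_ _≡_ f
    f-injective = proj₁ clique

    f-adjacent : ∀ i j → i ≢ j → E G (f i) (f j)
    f-adjacent = proj₂ clique

  δ : Fin k → Fin n → ℕ
  δ i y = dist (f i) y

  Nearest : Fin k → Fin n → Set
  Nearest a y = ∀ b → b ≢ a → δ a y < δ b y

  Equidistant : Fin n → Set
  Equidistant y = ∀ i j → δ i y ≡ δ j y

  equidistant? : Decidable Equidistant
  equidistant? y = all? (λ i → all? (λ j → δ i y ≟ℕ δ j y))

  nearest-unique : ∀ {a b y} → Nearest a y → Nearest b y → a ≡ b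
  nearest-unique {a} {b} a-near b-near with a ≟Fin b
  ... | yes a≡b = a≡b
  ... | no a≢b  = ⊥-elim (<-asym (a-near b (a≢b ∘ sym)) (b-near a a≢b))

  tie-forbids-farther : ∀ {i j w y} → i ≢ j → δ i y ≡ δ j y → δ w y ≢ suc (δ i y)
  tie-forbids-farther {i} {j} {w} {y} i≢j tie farther =
    i≢j (f-injective (geodesic-successor-unique (f-adjacent w i w≢i) (f-adjacent w j w≢j)
          (geodesic (f i) y) (geodesic-of-length (sym tie)) farther))
    where
    w≢i : w ≢ i
    w≢i refl = 1+n≢n (sym farther)
    w≢j : w ≢ j
    w≢j refl = 1+n≢n (sym (trans farther (cong suc tie)))

  equidistant-or-nearest : ∀ y → Equidistant y ⊎ ∃ λ a → Nearest a y
  equidistant-or-nearest y with any? U?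
  ... | no no-index = inj₁ λ i _ → ⊥-elim (no-index (i , tt))
  ... | yes some-index with minimiser U? (λ i → δ i y) some-index
  ... | a , _ , a-min
    with any? (λ b → ¬? (b ≟Fin a) ×-dec (δ b y ≟ℕ δ a y))
  ... | no no-tie = inj₂ (a , λ b b≢a → ≤∧≢⇒< (a-min tt) (λ tie → no-tie (b , b≢a , sym tie)))
  ... | yes (b , b≢a , tie) = inj₁ λ i j → trans (at-minimum i) (sym (at-minimum j))
    where
    at-minimum : ∀ w → δ w y ≡ δ a y
    at-minimum w with w ≟Fin a
    ... | yes refl = refl
    ... | no w≢a with m≤n⇒m<n∨m≡n (dist-stepˡ {z = y} (f-adjacent w a w≢a))
    ...   | inj₁ w<a+1 = ≤-antisym (≤-pred w<a+1) (a-min tt)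
    ...   | inj₂ farther = ⊥-elim (tie-forbids-farther (b≢a ∘ sym) (sym tie) farther)

  nearest-edge-balanced : ∀ {i j y y′} → i ≢ j → Nearest i y → Nearest j y′ → E G y y′ →
                          δ i y ≡ δ j y′
  nearest-edge-balanced {i} {j} i≢j y-near y′-near e =
    ≤-antisym (≤-pred (<-≤-trans (y-near j (i≢j ∘ sym)) (dist-stepʳ e)))
              (≤-pred (<-≤-trans (y′-near i i≢j) (dist-stepʳ (E-sym G e))))

  -- If y ≠ f i, the geodesic from f j to y is f j, f i, …, y; by uniqueness the geodesic
  -- from f j to y′ also passes through f i, so f i is closer to y′ than f j is.
  nearest-edge : ∀ {i j y y′} → i ≢ j → Nearest i y → Nearest j y′ → E G y y′ → y ≡ f i
  nearest-edge {i} {j} {y} {y′} i≢j y-near y′-near e = from-dist (δ i y) refl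
    where
    balanced : δ i y ≡ δ j y′
    balanced = nearest-edge-balanced i≢j y-near y′-near e
    from-dist : ∀ d → δ i y ≡ d → y ≡ f i
    from-dist zero    δ≡0 = sym (dist≡0⇒≡ δ≡0)
    from-dist (suc d) δ≡  with uncons G (geodesic-of-length (trans (sym balanced) δ≡))
    ... | c , fj-c , c-y′ = ⊥-elim (<⇒≱ i-farther (dist-minimal (subst (λ t → Walk G t y′ d)
                                                                        (sym fi≡c) c-y′)))
      where
      j-dist-y : δ j y ≡ suc (suc d)
      j-dist-y = ≤-antisym (subst (λ t → δ j y ≤ suc t) (trans (sym balanced) δ≡) (dist-stepʳ e))
                           (subst (_< δ j y) δ≡ (y-near j (i≢j ∘ sym)))
      fi≡c : f i ≡ c
      fi≡c = geodesic-successor-unique (f-adjacent j i (i≢j ∘ sym)) fj-c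
               (geodesic-of-length δ≡) (snoc G c-y′ (E-sym G e)) j-dist-y
      i-farther : d < δ i y′
      i-farther = ≤-trans (n≤1+n (suc d))
                    (subst (_< δ i y′) (trans (sym balanced) δ≡) (y′-near i i≢j))

  ¬Nearest-other-clique-vertex : ∀ {a w} → w ≢ a → ¬ Nearest a (f w)
  ¬Nearest-other-clique-vertex {a} {w} w≢a near =
    n≮0 (subst (δ a (f w) <_) (dist-refl (f w)) (near w w≢a))

  nearest-along-walk : ∀ {a y t l} → (∀ x → ¬ Equidistant x) → (p : Walk G y t l) →
                       All (_≢ f a) (vertices G p) → Nearest a y → Nearest a t
  nearest-along-walk _ (here _) _ y-near = y-near
  nearest-along-walk {a} none (step {v = y′} e p) (y≢fa ∷ p-avoids) y-near
    with equidistant-or-nearest y′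
  ... | inj₁ equidistant = ⊥-elim (none y′ equidistant)
  ... | inj₂ (b , y′-near) with b ≟Fin a
  ...   | yes refl = nearest-along-walk none p p-avoids y′-near
  ...   | no b≢a   = ⊥-elim (y≢fa (nearest-edge (b≢a ∘ sym) y-near y′-near e))

  equidistant-exists : 1 < k → (∀ x → ConnectedWithout G x) → (∃ λ x → ∀ i → x ≢ f i) →
                       ∃ Equidistant
  equidistant-exists 1<k connected-without (x , x∉) with any? equidistant?
  ... | yes found = found
  ... | no none with equidistant-or-nearest x
  ...   | inj₁ equidistant = ⊥-elim (none (x , equidistant))
  ...   | inj₂ (a , x-near) with other-index 1<k a
  ...     | w , w≢a with connected-without (f a) x (f w) (x∉ a) (w≢a ∘ f-injective)
  ...       | _ , p , p-avoids =
    ⊥-elim (¬Nearest-other-clique-vertex w≢a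
             (nearest-along-walk (λ y e → none (y , e)) p p-avoids x-near))

  module LeavesAround (z : Fin n) (d : ℕ) (z-dist : ∀ i → δ i z ≡ suc (suc d))
                      (z-closest : ∀ {y} → Equidistant y → ∀ i → suc (suc d) ≤ δ i y) where

    private
      successor : ∀ i → ∃ λ v → E G z v × Walk G v (f i) (suc d)
      successor i = uncons G (geodesic-of-length (trans (dist-sym z (f i)) (z-dist i)))

    leaf : Fin k → Fin n
    leaf i = proj₁ (successor i)

    leaf-adjacent : ∀ i → E G z (leaf i)
    leaf-adjacent i = proj₁ (proj₂ (successor i))

    leaf-close : ∀ i → δ i (leaf i) ≤ suc d
    leaf-close i = dist-minimal (reverse G (proj₂ (proj₂ (successor i))))

    leaf-far : ∀ i j → suc d ≤ δ j (leaf i)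
    leaf-far i j = ≤-pred (subst (_≤ suc (δ j (leaf i))) (z-dist j) (dist-stepʳ (leaf-adjacent i)))

    leaf-nearest : ∀ i → Nearest i (leaf i)
    leaf-nearest i with equidistant-or-nearest (leaf i)
    ... | inj₁ equidistant = ⊥-elim (<⇒≱ (s≤s (leaf-close i)) (z-closest equidistant i))
    ... | inj₂ (a , near) with a ≟Fin i
    ...   | yes refl = near
    ...   | no a≢i   = ⊥-elim (<⇒≱ (<-≤-trans (near i (a≢i ∘ sym)) (leaf-close i)) (leaf-far i a))

    leaf-injective : Injective _≡_ _≡_ leaf
    leaf-injective {i} {j} eq = nearest-unique (leaf-nearest i)
                                  (subst (Nearest j) (sym eq) (leaf-nearest j))

    leaves-independent : ∀ i j → ¬ E G (leaf i) (leaf j)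
    leaves-independent i j e with i ≟Fin j
    ... | yes refl = E-irrefl G e
    ... | no i≢j   = n≮0 (subst (d <_) leaf-at-distance-0 (leaf-far i i))
      where
      leaf-at-distance-0 : δ i (leaf i) ≡ 0
      leaf-at-distance-0 = trans (cong (δ i) (nearest-edge i≢j (leaf-nearest i) (leaf-nearest j) e))
                                 (dist-refl (f i))

    star : HasInducedStar G k
    star = z , leaf , leaf-injective , leaf-adjacent , leaves-independent

  induced-star : 1 < k → Maximal G f → ∃ Equidistant → HasInducedStar G k
  induced-star 1<k maximal found with distinct-pair 1<k
  ... | i₀ , i₁ , i₀≢i₁ with minimiser equidistant? (δ i₀) found
  ... | z , z-equidistant , z-min = by-distance (δ i₀ z) refl
    where
    by-distance : ∀ D → δ i₀ z ≡ D → HasInducedStar G k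
    by-distance zero δ≡0 =
      ⊥-elim (i₀≢i₁ (f-injective (trans (dist≡0⇒≡ δ≡0)
                                        (sym (dist≡0⇒≡ (trans (z-equidistant i₁ i₀) δ≡0))))))
    by-distance (suc zero) δ≡1 =
      ⊥-elim (maximal z (λ i → E-sym G (dist≡1⇒E (trans (z-equidistant i i₀) δ≡1))))
    by-distance (suc (suc d)) δ≡ = LeavesAround.star z d (λ i → trans (z-equidistant i i₀) δ≡)
      (λ {y} equidistant i → subst (_≤ δ i y) δ≡ (subst (δ i₀ z ≤_) (equidistant i₀ i)
                                                         (z-min equidistant)))

corollary1 : ∀ {n} (G : Graph n) (m : ℕ) → Geodetic G → TwoConnected G →
    ¬ Complete G → 1 < m → HasClique G m → HasInducedStar G m
corollary1 G m geodetic (_ , _ , connected-without) incomplete 1<m (_ , clique)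
  with extend-to-maximal G clique
... | k , m≤k , g , g-clique , g-maximal =
  HasInducedStar-mono G m≤k
    (induced-star 1<k g-maximal
      (equidistant-exists 1<k connected-without (vertex-outside-clique G g-clique incomplete)))
  where
  open CliqueRegions geodetic g-clique
  1<k : 1 < k
  1<k = ≤-trans 1<m m≤k
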